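{- Let $m,n\ge1$ and let $F$ be a frieze on the annulus $A_{m,n}$ (not assumed integral or positive). If $F(\gamma)\in\mathbb Z$ for every bridging arc $\gamma$ of $A_{m,n}$, then $F(\gamma)\in\mathbb Z$ for every arc $\gamma$ of $A_{m,n}$.
   Context: $A_{m,n}$ is an annulus with $m$ marked points on one boundary component and $n$ marked points on the other. An arc is a non-contractible simple curve in the annulus with endpoints at marked points, considered up to isotopy; boundary segments between consecutive marked points are arcs too. An arc is bridging if its endpoints lie on different boundary components. A quadrilateral $ABCD$ is a collection of pairwise non-crossing arcs $AB,BC,CD,DA$ cutting out a disc with vertices $A,B,C,D$ in this cyclic order. A frieze (here) is an assignment of a real number $F(\gamma)$ to every arc $\gamma$ such that $F(\delta)=1$ for every boundary segment $\delta$ and $F(AC)F(BD)=F(AB)F(CD)+F(BC)F(AD)$ for every quadrilateral $ABCD$. -}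

module Defs where

open import Level using (Level; _⊔_)
open import Data.Nat as ℕ using (ℕ; zero; suc)
open import Data.Integer as ℤ using (ℤ; +_; -[1+_])
open import Data.Product using (Σ; _×_; _,_; ∃)
open import Data.Sum using (_⊎_)
open import Data.Unit using (⊤)
open import Data.Empty using (⊥)
open import Relation.Nullary using (¬_)
open import Relation.Binary.PropositionalEquality using (_≡_)
open import Algebra.Bundles using (CommutativeRing)

-- Scalars.  The paper's friezes take real values; Agda has no reals, so
-- we let the values live in an arbitrary field of characteristic 0
-- (ℝ being one instance).

module _ {c ℓ} (R : CommutativeRing c ℓ) where
  open CommutativeRing R
  natCast : ℕ → Carrier
  natCast zero    = 0#
  natCast (suc k) = 1# + natCast k
  intCast : ℤ → Carrier
  intCast (+ k)      = natCast k
  intCast -[1+ k ]   = - natCast (suc k)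

record Char0Field (c ℓ : Level) : Set (Level.suc (c ⊔ ℓ)) where
  field
    cring : CommutativeRing c ℓ
  open CommutativeRing cring public hiding (ring)
  field
    nontrivial : ¬ (1# ≈ 0#)
    inverse    : ∀ x → ¬ (x ≈ 0#) → Σ Carrier λ y → x * y ≈ 1#
    char0      : ∀ k → ¬ (natCast cring (suc k) ≈ 0#)
  IsInt : Carrier → Set ℓ
  IsInt x = Σ ℤ λ z → x ≈ intCast cring z

-- Universal cover of the annulus A_{m,n}: the strip ℝ × [0,1] with the
-- outer boundary's marked points at the integers on the top line and the
-- inner boundary's marked points at the integers on the bottom line.
-- The deck transformation τ shifts outer points by m and inner points by n.

data Pt : Set where
  out : ℤ → Pt
  inn : ℤ → Pt

shift : ℕ → ℕ → ℤ → Pt → Pt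
shift m n k (out a) = out (a ℤ.+ k ℤ.* + m)
shift m n k (inn b) = inn (b ℤ.+ k ℤ.* + n)

Near : ℕ → ℤ → ℤ → Set
Near k a b = (a ℤ.< b × b ℤ.≤ a ℤ.+ + k) ⊎ (b ℤ.< a × a ℤ.≤ b ℤ.+ + k)

-- A chord p—q of the strip which projects to an arc of A_{m,n}.
-- Two chords give the same arc iff they differ by some τ^k and/or by
-- swapping endpoints.  Peripheral chords a—b on one line project to simple
-- non-contractible curves iff 1 ≤ |a-b| ≤ (number of points on that side);
-- bridging chords always project to arcs.
IsArc : ℕ → ℕ → Pt → Pt → Set
IsArc m n (out a) (out b) = Near m a b
IsArc m n (inn a) (inn b) = Near n a b
IsArc m n (out a) (inn b) = ⊤
IsArc m n (inn a) (out b) = ⊤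

IsBridging : Pt → Pt → Set
IsBridging (out a) (inn b) = ⊤
IsBridging (inn a) (out b) = ⊤
IsBridging _ _ = ⊥

IsBoundarySeg : Pt → Pt → Set
IsBoundarySeg (out a) (out b) = (b ≡ a ℤ.+ + 1) ⊎ (a ≡ b ℤ.+ + 1)
IsBoundarySeg (inn a) (inn b) = (b ≡ a ℤ.+ + 1) ⊎ (a ≡ b ℤ.+ + 1)
IsBoundarySeg _ _ = ⊥

-- Linear order of the marked points along the boundary of the strip:
-- the top line from left to right, then the bottom line from right to
-- left.  Closing it up (through the ends at ±∞) gives the cyclic order.
_≺_ : Pt → Pt → Set
out a ≺ out b = a ℤ.< b
out a ≺ inn b = ⊤
inn a ≺ out b = ⊥
inn a ≺ inn b = b ℤ.< a

_≼_ : Pt → Pt → Set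
p ≼ q = (p ≺ q) ⊎ (p ≡ q)

InSeg : Pt → Pt → Pt → Set
InSeg x y z = x ≼ z × z ≼ y

InWrap : Pt → Pt → Pt → Set
InWrap D A z = D ≼ z ⊎ z ≼ A

All4 : (Pt → Set) → Pt → Pt → Pt → Pt → Set
All4 P a b c d = P a × P b × P c × P d

-- The quadrilateral with (cyclically ordered) vertices A B C D and the
-- quadrilateral with vertices A' B' C' D' have disjoint interiors:
-- all vertices of the second lie in one closed boundary interval between
-- consecutive vertices of the first.
DisjointQuads : Pt → Pt → Pt → Pt → Pt → Pt → Pt → Pt → Set
DisjointQuads A B C D A' B' C' D' =
  All4 (InSeg A B) A' B' C' D' ⊎ All4 (InSeg B C) A' B' C' D' ⊎
  All4 (InSeg C D) A' B' C' D' ⊎ All4 (InWrap D A) A' B' C' D'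

-- A quadrilateral ABCD of A_{m,n}, given by a lift to the strip: four
-- marked points in cyclic order, all sides and diagonals arcs, such that
-- the lifted disc is disjoint from all its nontrivial deck translates
-- (i.e. it maps injectively onto a disc in the annulus cut out by the
-- projected sides).
record IsQuadrilateral (m n : ℕ) (A B C D : Pt) : Set where
  field
    ordAB : A ≺ B
    ordBC : B ≺ C
    ordCD : C ≺ D
    arcAB : IsArc m n A B
    arcBC : IsArc m n B C
    arcCD : IsArc m n C D
    arcDA : IsArc m n D A
    arcAC : IsArc m n A C
    arcBD : IsArc m n B D
    embedded : ∀ (k : ℤ) → ¬ (k ≡ + 0) →
      DisjointQuads A B C D
        (shift m n k A) (shift m n k B) (shift m n k C) (shift m n k D)

-- Values on
-- pairs that are not arcs are irrelevant junk.

record IsFrieze {c ℓ} (K : Char0Field c ℓ) (m n : ℕ) (F : Pt → Pt → Char0Field.Carrier K) : Set (c ⊔ ℓ) where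
  open Char0Field K
  field
    symm      : ∀ p q → IsArc m n p q → F p q ≈ F q p
    invariant : ∀ k p q → IsArc m n p q → F (shift m n k p) (shift m n k q) ≈ F p q
    boundary  : ∀ p q → IsBoundarySeg p q → F p q ≈ 1#
    ptolemy   : ∀ A B C D → IsQuadrilateral m n A B C D →
      F A C * F B D ≈ F A B * F C D + F B C * F D A

-- A peripheral arc ab, together with a boundary segment cd on the other boundary
-- component, cuts out a quadrilateral abcd whose four remaining arcs are bridging.
-- As F(cd) = 1, the Ptolemy relation F(ac)F(bd) = F(ab)F(cd) + F(bc)F(da) writes F(ab)
-- as a difference of products of integers; symmetrically for the other boundary.

module Submission where

open import Defs
open import Algebra.Bundles using (CommutativeRing)
open import Data.Maybe using (nothing)
open import Data.Nat as ℕ using (ℕ; zero; suc)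
open import Data.Integer as ℤ using (ℤ; +_; -[1+_])
open import Data.Product using (Σ; ∃₂; _,_)
open import Data.Sum using (inj₁; inj₂)
open import Data.Unit using (tt)
import Relation.Binary.PropositionalEquality as ≡

module IntegerElements {c ℓ} (R : CommutativeRing c ℓ) where
  open CommutativeRing R
  open import Algebra.Properties.Semiring.Mult semiring using (_×_; ×-homo-+; ×1-homo-*)
  open import Algebra.Properties.Group +-group using (∙-cancelˡ; inverseˡ-unique)
  open import Algebra.Solver.Ring.NaturalCoefficients commutativeSemiring (λ _ _ → nothing)
    using (solve; _:=_; _:+_; _:*_)
  open import Relation.Binary.Reasoning.Setoid setoid

  IsInt : Carrier → Set ℓ
  IsInt x = Σ ℤ λ z → x ≈ intCast R z

  isInt-resp-≈ : ∀ {x y} → x ≈ y → IsInt x → IsInt y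
  isInt-resp-≈ x≈y (z , x≈z) = z , trans (sym x≈y) x≈z

  private
    ι : ℕ → Carrier
    ι = natCast R

  natCast≈×1# : ∀ k → natCast R k ≈ k × 1#
  natCast≈×1# zero    = refl
  natCast≈×1# (suc k) = +-cong refl (natCast≈×1# k)

  natCast-+ : ∀ a b → ι (a ℕ.+ b) ≈ ι a + ι b
  natCast-+ a b = begin
    ι (a ℕ.+ b)          ≈⟨ natCast≈×1# (a ℕ.+ b) ⟩
    (a ℕ.+ b) × 1#       ≈⟨ ×-homo-+ 1# a b ⟩
    a × 1# + b × 1#      ≈⟨ +-cong (natCast≈×1# a) (natCast≈×1# b) ⟨
    ι a + ι b            ∎

  natCast-* : ∀ a b → ι (a ℕ.* b) ≈ ι a * ι b
  natCast-* a b = begin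
    ι (a ℕ.* b)          ≈⟨ natCast≈×1# (a ℕ.* b) ⟩
    (a ℕ.* b) × 1#       ≈⟨ ×1-homo-* a b ⟩
    (a × 1#) * (b × 1#)  ≈⟨ *-cong (natCast≈×1# a) (natCast≈×1# b) ⟨
    ι a * ι b            ∎

  -- x = p - q with p q : ℕ; unlike ℤ this representation has no sign cases.
  IsNatDiff : Carrier → Set ℓ
  IsNatDiff x = ∃₂ λ p q → x + ι q ≈ ι p

  isInt⇒isNatDiff : ∀ {x} → IsInt x → IsNatDiff x
  isInt⇒isNatDiff {x} (+ k      , x≈k)  = k , 0 , trans (+-identityʳ x) x≈k
  isInt⇒isNatDiff {x} (-[1+ k ] , x≈-k) = 0 , suc k , trans (+-cong x≈-k refl) (-‿inverseˡ _)

  isNatDiff⇒isInt : ∀ {x} → IsNatDiff x → IsInt x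
  isNatDiff⇒isInt {x} (p , q , x+q≈p) = diff⇒isInt p q x+q≈p
    where
    diff⇒isInt : ∀ p q → x + ι q ≈ ι p → IsInt x
    diff⇒isInt p       zero    x≈p        = + p , trans (sym (+-identityʳ x)) x≈p
    diff⇒isInt zero    (suc q) x+q≈0      = -[1+ q ] , inverseˡ-unique x (ι (suc q)) x+q≈0
    diff⇒isInt (suc p) (suc q) x+1+q≈1+p = diff⇒isInt p q (∙-cancelˡ 1# _ _ (begin
      1# + (x + ι q)     ≈⟨ solve 3 (λ o u v → o :+ (u :+ v) := u :+ (o :+ v)) refl 1# x (ι q) ⟩
      x + (1# + ι q)     ≈⟨ x+1+q≈1+p ⟩
      1# + ι p           ∎))

  isNatDiff-* : ∀ {x y} → IsNatDiff x → IsNatDiff y → IsNatDiff (x * y)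
  isNatDiff-* {x} {y} (p , q , x+q≈p) (r , s , y+s≈r) =
    p ℕ.* r ℕ.+ q ℕ.* s , p ℕ.* s ℕ.+ q ℕ.* r , (begin
    x * y + ι (p ℕ.* s ℕ.+ q ℕ.* r)   ≈⟨ +-cong refl (ι-+* p s q r) ⟩
    x * y + (ι p * ι s + ι q * ι r)   ≈⟨ +-cong refl (+-cong (*-cong x+q≈p refl) (*-cong refl y+s≈r)) ⟨
    x * y + ((x + ι q) * ι s + ι q * (y + ι s))
      ≈⟨ solve 4 (λ x y q s → x :* y :+ ((x :+ q) :* s :+ q :* (y :+ s)) := (x :+ q) :* (y :+ s) :+ q :* s)
               refl x y (ι q) (ι s) ⟩
    (x + ι q) * (y + ι s) + ι q * ι s ≈⟨ +-cong (*-cong x+q≈p y+s≈r) refl ⟩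
    ι p * ι r + ι q * ι s             ≈⟨ ι-+* p r q s ⟨
    ι (p ℕ.* r ℕ.+ q ℕ.* s)           ∎)
    where
    ι-+* : ∀ a b c d → ι (a ℕ.* b ℕ.+ c ℕ.* d) ≈ ι a * ι b + ι c * ι d
    ι-+* a b c d = trans (natCast-+ (a ℕ.* b) (c ℕ.* d)) (+-cong (natCast-* a b) (natCast-* c d))

  isNatDiff-+-cancelʳ : ∀ {x y z} → x + y ≈ z → IsNatDiff y → IsNatDiff z → IsNatDiff x
  isNatDiff-+-cancelʳ {x} {y} {z} x+y≈z (p , q , y+q≈p) (r , s , z+s≈r) =
    r ℕ.+ q , s ℕ.+ p , (begin
    x + ι (s ℕ.+ p)              ≈⟨ +-cong refl (natCast-+ s p) ⟩
    x + (ι s + ι p)              ≈⟨ +-cong refl (+-cong refl y+q≈p) ⟨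
    x + (ι s + (y + ι q))
      ≈⟨ solve 4 (λ x y s q → x :+ (s :+ (y :+ q)) := ((x :+ y) :+ s) :+ q) refl x y (ι s) (ι q) ⟩
    ((x + y) + ι s) + ι q        ≈⟨ +-cong (+-cong x+y≈z refl) refl ⟩
    (z + ι s) + ι q              ≈⟨ +-cong z+s≈r refl ⟩
    ι r + ι q                    ≈⟨ natCast-+ r q ⟨
    ι (r ℕ.+ q)                  ∎)

  isInt-* : ∀ {x y} → IsInt x → IsInt y → IsInt (x * y)
  isInt-* ix iy = isNatDiff⇒isInt (isNatDiff-* (isInt⇒isNatDiff ix) (isInt⇒isNatDiff iy))

  isInt-+-cancelʳ : ∀ {x y z} → x + y ≈ z → IsInt y → IsInt z → IsInt x
  isInt-+-cancelʳ x+y≈z iy iz =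
    isNatDiff⇒isInt (isNatDiff-+-cancelʳ x+y≈z (isInt⇒isNatDiff iy) (isInt⇒isNatDiff iz))

module Strip where
  open import Data.Nat using (z≤n; s≤s)
  open import Data.Integer
    using (ℤ; +_; -[1+_]; +[1+_]; _+_; _-_; _*_; -_; _≤_; _<_; _≟_; 1ℤ; -1ℤ; +≤+; -≤-)
  open import Data.Integer.Properties
    using (≤∧≢⇒<; i≤i+j; *-identityˡ; -1*i≡-i; +-monoʳ-≤; +-monoˡ-≤; *-monoʳ-≤-nonNeg
          ; +-0-abelianGroup; module ≤-Reasoning)
  open import Algebra.Bundles using (AbelianGroup)
  open import Algebra.Properties.Group (AbelianGroup.group +-0-abelianGroup) using (//-rightDividesʳ)
  open import Relation.Nullary using (yes; no; contradiction)
  open import Relation.Binary.PropositionalEquality using (refl; cong; _≢_)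

  ≤⇒out≼out : ∀ {a b} → a ≤ b → out a ≼ out b
  ≤⇒out≼out {a} {b} a≤b with a ≟ b
  ... | yes refl = inj₂ refl
  ... | no  a≢b  = inj₁ (≤∧≢⇒< a≤b a≢b)

  ≥⇒inn≼inn : ∀ {a b} → b ≤ a → inn a ≼ inn b
  ≥⇒inn≼inn {a} {b} b≤a with b ≟ a
  ... | yes refl = inj₂ refl
  ... | no  b≢a  = inj₁ (≤∧≢⇒< b≤a b≢a)

  module _ (j : ℤ) (n : ℕ) {i k : ℤ} (i≤j+n : i ≤ j + + n) where
    open ≤-Reasoning

    i≤j+n⇒i≤j+k*n : 1ℤ ≤ k → i ≤ j + k * + n
    i≤j+n⇒i≤j+k*n 1≤k = begin
      i              ≤⟨ i≤j+n ⟩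
      j + + n        ≡⟨ cong (_+_ j) (*-identityˡ (+ n)) ⟨
      j + 1ℤ * + n   ≤⟨ +-monoʳ-≤ j (*-monoʳ-≤-nonNeg (+ n) 1≤k) ⟩
      j + k * + n    ∎

    i≤j+n⇒i+k*n≤j : k ≤ -1ℤ → i + k * + n ≤ j
    i≤j+n⇒i+k*n≤j k≤-1 = begin
      i + k * + n    ≤⟨ +-monoʳ-≤ i (*-monoʳ-≤-nonNeg (+ n) k≤-1) ⟩
      i + -1ℤ * + n  ≡⟨ cong (_+_ i) (-1*i≡-i (+ n)) ⟩
      i - + n        ≤⟨ +-monoˡ-≤ (- + n) i≤j+n ⟩
      j + + n - + n  ≡⟨ //-rightDividesʳ (+ n) j ⟩
      j              ∎

  isQuadrilateral-outer-inner : ∀ {m n a b c d} →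
    a < b → b ≤ a + + m → d < c → c ≤ d + + n →
    IsQuadrilateral m n (out a) (out b) (inn c) (inn d)
  isQuadrilateral-outer-inner {m} {n} {a} {b} {c} {d} a<b b≤a+m d<c c≤d+n = record
    { ordAB = a<b ; ordBC = tt ; ordCD = d<c
    ; arcAB = inj₁ (a<b , b≤a+m) ; arcBC = tt ; arcCD = inj₂ (d<c , c≤d+n)
    ; arcDA = tt ; arcAC = tt ; arcBD = tt
    ; embedded = embedded }
    where
    a≤a+m : a ≤ a + + m
    a≤a+m = i≤i+j a (+ m)
    b≤b+m : b ≤ b + + m
    b≤b+m = i≤i+j b (+ m)
    c≤c+n : c ≤ c + + n
    c≤c+n = i≤i+j c (+ n)
    d≤d+n : d ≤ d + + n
    d≤d+n = i≤i+j d (+ n)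
    -- Positive translates land in the boundary interval from b to c, negative ones in
    -- the interval from d through the ends back to a.
    embedded : ∀ k → k ≢ + 0 → DisjointQuads (out a) (out b) (inn c) (inn d)
      (shift m n k (out a)) (shift m n k (out b)) (shift m n k (inn c)) (shift m n k (inn d))
    embedded (+ 0) k≢0 = contradiction refl k≢0
    embedded +[1+ j ] _ = inj₂ (inj₁
      ( (≤⇒out≼out (i≤j+n⇒i≤j+k*n a m b≤a+m 1≤k) , inj₁ tt)
      , (≤⇒out≼out (i≤j+n⇒i≤j+k*n b m b≤b+m 1≤k) , inj₁ tt)
      , (inj₁ tt , ≥⇒inn≼inn (i≤j+n⇒i≤j+k*n c n c≤c+n 1≤k))
      , (inj₁ tt , ≥⇒inn≼inn (i≤j+n⇒i≤j+k*n d n c≤d+n 1≤k))))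
      where
      1≤k : 1ℤ ≤ +[1+ j ]
      1≤k = +≤+ (s≤s z≤n)
    embedded -[1+ j ] _ = inj₂ (inj₂ (inj₂
      ( inj₂ (≤⇒out≼out (i≤j+n⇒i+k*n≤j a m a≤a+m k≤-1))
      , inj₂ (≤⇒out≼out (i≤j+n⇒i+k*n≤j a m b≤a+m k≤-1))
      , inj₁ (≥⇒inn≼inn (i≤j+n⇒i+k*n≤j d n c≤d+n k≤-1))
      , inj₁ (≥⇒inn≼inn (i≤j+n⇒i+k*n≤j d n d≤d+n k≤-1)))))
      where
      k≤-1 : -[1+ j ] ≤ -1ℤ
      k≤-1 = -≤- z≤n

open Strip using (isQuadrilateral-outer-inner)
open import Data.Nat using (_≤_)

module _ {c ℓ} {K : Char0Field c ℓ} {m n : ℕ} {F : Pt → Pt → Char0Field.Carrier K}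
         (frieze : IsFrieze K m n F) where
  open Char0Field K
  open IsFrieze frieze
  open IntegerElements cring using (isInt-resp-≈; isInt-*; isInt-+-cancelʳ)

  isInt-ptolemy : ∀ {A B C D} → IsQuadrilateral m n A B C D →
    IsInt (F A C) → IsInt (F B D) → IsInt (F B C) → IsInt (F D A) → IsInt (F A B * F C D)
  isInt-ptolemy quad iAC iBD iBC iDA =
    isInt-+-cancelʳ (sym (ptolemy _ _ _ _ quad)) (isInt-* iBC iDA) (isInt-* iAC iBD)

  isInt-swap : ∀ {p q} → IsArc m n q p → IsInt (F q p) → IsInt (F p q)
  isInt-swap {p} {q} arc = isInt-resp-≈ (symm q p arc)

  module _ (bridging : ∀ p q → IsBridging p q → IsInt (F p q)) where

    isInt-outer : 1 ≤ n → ∀ {a b} → IsArc m n (out a) (out b) → IsInt (F (out a) (out b))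
    isInt-outer 1≤n {a} {b} (inj₁ (a<b , b≤a+m)) = isInt-resp-≈ F[ab]*1≈F[ab]
      (isInt-ptolemy (isQuadrilateral-outer-inner a<b b≤a+m (ℤ.+<+ (ℕ.s≤s ℕ.z≤n)) (ℤ.+≤+ 1≤n))
        (bridging _ _ tt) (bridging _ _ tt) (bridging _ _ tt) (bridging _ _ tt))
      where
      F[ab]*1≈F[ab] : F (out a) (out b) * F (inn (+ 1)) (inn (+ 0)) ≈ F (out a) (out b)
      F[ab]*1≈F[ab] = trans (*-cong refl (boundary _ _ (inj₂ ≡.refl))) (*-identityʳ _)
    isInt-outer 1≤n (inj₂ arc) = isInt-swap (inj₁ arc) (isInt-outer 1≤n (inj₁ arc))

    isInt-inner : 1 ≤ m → ∀ {c d} → IsArc m n (inn c) (inn d) → IsInt (F (inn c) (inn d))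
    isInt-inner 1≤m {c} {d} (inj₂ (d<c , c≤d+n)) = isInt-resp-≈ 1*F[cd]≈F[cd]
      (isInt-ptolemy (isQuadrilateral-outer-inner (ℤ.+<+ (ℕ.s≤s ℕ.z≤n)) (ℤ.+≤+ 1≤m) d<c c≤d+n)
        (bridging _ _ tt) (bridging _ _ tt) (bridging _ _ tt) (bridging _ _ tt))
      where
      1*F[cd]≈F[cd] : F (out (+ 0)) (out (+ 1)) * F (inn c) (inn d) ≈ F (inn c) (inn d)
      1*F[cd]≈F[cd] = trans (*-cong (boundary _ _ (inj₁ ≡.refl)) refl) (*-identityˡ _)
    isInt-inner 1≤m (inj₁ arc) = isInt-swap (inj₂ arc) (isInt-inner 1≤m (inj₂ arc))

lemma3p4 : ∀ {c ℓ} (K : Char0Field c ℓ) (m n : ℕ) → 1 ≤ m → 1 ≤ n →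
    (F : Pt → Pt → Char0Field.Carrier K) → IsFrieze K m n F →
    (∀ p q → IsBridging p q → Char0Field.IsInt K (F p q)) →
    ∀ p q → IsArc m n p q → Char0Field.IsInt K (F p q)
lemma3p4 K m n 1≤m 1≤n F frieze bridging (out a) (out b) arc = isInt-outer frieze bridging 1≤n arc
lemma3p4 K m n 1≤m 1≤n F frieze bridging (inn c) (inn d) arc = isInt-inner frieze bridging 1≤m arc
lemma3p4 K m n 1≤m 1≤n F frieze bridging (out a) (inn d) _   = bridging _ _ tt
lemma3p4 K m n 1≤m 1≤n F frieze bridging (inn c) (out b) _   = bridging _ _ tt
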